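{- Let $G=B(d(0),d(1),\dots,d(n-1))$ be a generalized Bethe tree with $n\ge1$, and set $d(n)=0$. Define polynomials $g_0(\lambda)=1$, $g_1(\lambda)=\lambda$, $g_i(\lambda)=(d(n-i+1)+1)\lambda g_{i-1}(\lambda)-d(n-i+1)g_{i-2}(\lambda)$ for $i\in[2,n]$, and $g_{n+1}(\lambda)=d(0)\big(\lambda g_n(\lambda)-g_{n-1}(\lambda)\big)$, and let $\tilde g_i$ denote the monic polynomial obtained by dividing $g_i$ by its leading coefficient. Let $M$ be the $(n+1)\times(n+1)$ symmetric tridiagonal matrix with zero diagonal, rows and columns indexed by $0,\dots,n$, whose $(j,j+1)$ and $(j+1,j)$ entries equal $\sqrt{D_j}$ for $j=0,\dots,n-1$, where $D_0=1/(d(1)+1)$ and $D_j=\dfrac{d(j)}{(d(j)+1)(d(j+1)+1)}$ for $1\le j\le n-1$. Let $p_0(\lambda)=1$ and, for $i\in[1,n+1]$, $p_i(\lambda)=\det(\lambda I_i-M^{(i)})$, where $M^{(i)}$ is the principal submatrix of $M$ obtained by deleting its first $n+1-i$ rows and first $n+1-i$ columns. Then $p_i(\lambda)=\tilde g_i(\lambda)$ for all $\lambda\in\mathbb{C}$ and all $i\in[0,n+1]$.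
   Context: A generalized Bethe tree $B(d(0),\dots,d(n-1))$ ($n\ge1$, all $d(i)\ge1$) is a rooted tree with levels $C_0=\{\text{root}\},\dots,C_n$ in which each vertex of $C_i$ ($0\le i\le n-1$) has exactly $d(i)$ children in $C_{i+1}$ and vertices of $C_n$ are leaves. The matrix $M$ is the matrix of $\mathcal{U}^{1/2}T\mathcal{U}^{ -1/2}$ ($T$ the simple random walk transition matrix, $\mathcal{U}$ the diagonal degree matrix) restricted to the span of the normalized level indicator vectors; $[i,j]=\{i,i+1,\dots,j\}$. -}

module Defs where

open import Level using (Level; _⊔_) renaming (suc to lsuc)
open import Data.Nat as ℕ using (ℕ; zero; suc; _∸_; _<_; _≤_)
open import Data.Integer as ℤ using (ℤ; +_; -[1+_])
open import Data.Fin as Fin using (Fin; toℕ; punchIn)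
open import Data.List using (List; []; _∷_; map)
open import Data.Bool using (if_then_else_)
open import Relation.Nullary using (¬_; yes; no)
open import Relation.Nullary.Decidable using (⌊_⌋)
open import Relation.Binary.PropositionalEquality using (_≡_)
open import Algebra.Bundles using (CommutativeRing)

-- Scalars: a field of characteristic zero (e.g. ℂ), given as a
-- commutative ring together with an inverse operation and char 0.

natR : ∀ {c ℓ} (R : CommutativeRing c ℓ) → ℕ → CommutativeRing.Carrier R
natR R zero    = CommutativeRing.0# R
natR R (suc m) = CommutativeRing._+_ R (CommutativeRing.1# R) (natR R m)

record CharZeroField (c ℓ : Level) : Set (lsuc (c ⊔ ℓ)) where
  field
    cring : CommutativeRing c ℓ
  open CommutativeRing cring public
  field
    inv      : Carrier → Carrier
    inv-law  : ∀ x → ¬ (x ≈ 0#) → x * inv x ≈ 1#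
    charZero : ∀ m → ¬ (natR cring (suc m) ≈ 0#)

  natK : ℕ → Carrier
  natK = natR cring

  intK : ℤ → Carrier
  intK (+ m)      = natK m
  intK -[1+ m ]   = - natK (suc m)

-- Polynomials with integer coefficients, as coefficient lists
-- (lowest degree first).

Poly : Set
Poly = List ℤ

infixl 6 _⊕_ _⊖_
_⊕_ : Poly → Poly → Poly
[]       ⊕ q        = q
(a ∷ p)  ⊕ []       = a ∷ p
(a ∷ p)  ⊕ (b ∷ q)  = (a ℤ.+ b) ∷ (p ⊕ q)

scale : ℤ → Poly → Poly
scale c p = map (c ℤ.*_) p

_⊖_ : Poly → Poly → Poly
p ⊖ q = p ⊕ scale (ℤ.- (+ 1)) q

mulX : Poly → Poly
mulX p = + 0 ∷ p

-- leading coefficient: the coefficient of highest degree that is nonzero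
-- (0 for the zero polynomial)
lead : Poly → ℤ
lead []       = + 0
lead (c ∷ cs) with lead cs ℤ.≟ + 0
... | yes _ = c
... | no  _ = lead cs

-- The generalized Bethe tree data: n ≥ 1 and d(0),…,d(n-1);
-- ext n d i = d(i) for i < n and 0 otherwise (so d(n) = 0).

ext : (n : ℕ) → (Fin n → ℕ) → ℕ → ℕ
ext n d i with i ℕ.<? n
... | yes i<n = d (Fin.fromℕ< i<n)
... | no  _   = 0

-- The polynomials g_i, i ∈ [0, n+1]  (values for i > n+1 are irrelevant):
--   g_0 = 1, g_1 = λ,
--   g_i = (d(n-i+1)+1) λ g_{i-1} - d(n-i+1) g_{i-2}   (2 ≤ i ≤ n),
--   g_{n+1} = d(0) (λ g_n - g_{n-1}).
-- one step of the recursion: computes g_{k+2} from g_{k+1} and g_k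
gstep : (n : ℕ) → (Fin n → ℕ) → ℕ → Poly → Poly → Poly
gstep n d k g₁ g₀ with suc k ℕ.≟ n
... | yes _ = scale (+ ext n d 0) (mulX g₁ ⊖ g₀)                    -- k+2 = n+1
... | no  _ = scale (+ suc (ext n d (n ∸ suc k))) (mulX g₁)          -- d(n-(k+2)+1) = d(n-(k+1))
              ⊖ scale (+ ext n d (n ∸ suc k)) g₀

g : (n : ℕ) → (Fin n → ℕ) → ℕ → Poly
g n d zero          = + 1 ∷ []
g n d (suc zero)    = + 0 ∷ + 1 ∷ []
g n d (suc (suc k)) = gstep n d k (g n d (suc k)) (g n d k)

module WithField {c ℓ : Level} (F : CharZeroField c ℓ) where
  open CharZeroField F

  eval : Poly → Carrier → Carrier
  eval []       x = 0#
  eval (a ∷ p)  x = intK a + x * eval p x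

  gTilde : (n : ℕ) → (Fin n → ℕ) → ℕ → Carrier → Carrier
  gTilde n d i x = inv (intK (lead (g n d i))) * eval (g n d i) x

  D : (n : ℕ) → (Fin n → ℕ) → ℕ → Carrier
  D n d zero    = inv (natK (suc (ext n d 1)))
  D n d (suc j) = natK (ext n d (suc j))
                  * inv (natK (suc (ext n d (suc j))) * natK (suc (ext n d (suc (suc j)))))

  -- the matrix M (rows/columns indexed 0..n by natural numbers), where
  -- s j plays the role of √D_j: entries (j,j+1) and (j+1,j) are s j,
  -- all other entries are 0.
  M : (ℕ → Carrier) → ℕ → ℕ → Carrier
  M s j k with k ℕ.≟ suc j | j ℕ.≟ suc k
  ... | yes _ | _     = s j
  ... | no _  | yes _ = s k
  ... | no _  | no _  = 0#

  Msub : (n : ℕ) → (ℕ → Carrier) → (i : ℕ) → Fin i → Fin i → Carrier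
  Msub n s i a b = M s (toℕ a ℕ.+ (suc n ∸ i)) (toℕ b ℕ.+ (suc n ∸ i))

  sumFin : (m : ℕ) → (Fin m → Carrier) → Carrier
  sumFin zero    f = 0#
  sumFin (suc m) f = f Fin.zero + sumFin m (λ j → f (Fin.suc j))

  sgn : ℕ → Carrier
  sgn zero    = 1#
  sgn (suc k) = - sgn k

  det : (m : ℕ) → (Fin m → Fin m → Carrier) → Carrier
  det zero    A = 1#
  det (suc m) A = sumFin (suc m) λ j →
    sgn (toℕ j) * (A Fin.zero j * det m (λ a b → A (Fin.suc a) (punchIn j b)))

  I : (m : ℕ) → Fin m → Fin m → Carrier
  I m a b with a Fin.≟ b
  ... | yes _ = 1#
  ... | no  _ = 0#

  p : (n : ℕ) → (ℕ → Carrier) → (i : ℕ) → Carrier → Carrier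
  p n s i x = det i (λ a b → x * I i a b - Msub n s i a b)

-- Both sides satisfy the same three-term recurrence
--   u (k+2) = λ u (k+1) − D (n−k−1) u k   (k+1 ≤ n),  u 0 = 1,  u 1 = λ,
-- so they agree on [0, n+1].  For p this is the Laplace expansion of the
-- tridiagonal determinant det(λI − M^{(k+2)}) along its first row, using
-- √D_j √D_j = D_j.  For g̃ it is the recurrence for g divided by the
-- leading coefficients: these multiply by d(n−k)+1 at every step up to n
-- and by d(0) at the last one, and D_j is exactly the ratio that makes
-- the normalised recurrence monic.
module Submission where

open import Level using (Level)
open import Data.Nat as ℕ using (ℕ; zero; suc; _∸_; _≤_; _<_; s≤s)
import Data.Nat.Properties as ℕP
open import Data.Integer as ℤ using (ℤ; +_; -[1+_])
import Data.Integer.Properties as ℤP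
import Data.Sign as Sign
open import Data.Fin as Fin using (Fin; toℕ)
open import Data.List using ([]; _∷_; length)
import Data.List.Properties as ListP
open import Data.Maybe using (Maybe; just; nothing)
open import Data.Sum using ([_,_]′)
open import Data.Product using (_×_; _,_; proj₂)
open import Data.Empty using (⊥-elim)
open import Relation.Nullary using (yes; no; Dec)
open import Relation.Binary.PropositionalEquality as ≡ using (_≡_; _≢_)
import Algebra.Solver.Ring.AlmostCommutativeRing as ACR

open import Defs

data HasDegree : Poly → ℕ → ℕ → Set where
  constant : ∀ {L} → L ≢ 0 → HasDegree (+ L ∷ []) 0 L
  shift    : ∀ {c p k L} → HasDegree p k L → HasDegree (c ∷ p) (suc k) L

HasDegree⇒lead≢0 : ∀ {p k L} → HasDegree p k L → L ≢ 0
HasDegree⇒lead≢0 (constant L≢0) = L≢0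
HasDegree⇒lead≢0 (shift h)      = HasDegree⇒lead≢0 h

lead-hasDegree : ∀ {p k L} → HasDegree p k L → lead p ≡ + L
lead-hasDegree (constant _) = ≡.refl
lead-hasDegree (shift {p = p} h) with lead p ℤ.≟ + 0 | lead-hasDegree h
... | yes lead≡0 | lead≡L =
  ⊥-elim (HasDegree⇒lead≢0 h (ℤP.+-injective (≡.trans (≡.sym lead≡L) lead≡0)))
... | no  _      | lead≡L = lead≡L

length-hasDegree : ∀ {p k L} → HasDegree p k L → length p ≡ suc k
length-hasDegree (constant _) = ≡.refl
length-hasDegree (shift h)    = ≡.cong suc (length-hasDegree h)

scale-hasDegree : ∀ {c p k L} → c ≢ 0 → HasDegree p k L → HasDegree (scale (+ c) p) k (c ℕ.* L)
scale-hasDegree {c} {L = L} c≢0 (constant L≢0) =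
  ≡.subst (λ a → HasDegree (a ∷ []) 0 (c ℕ.* L)) (ℤP.pos-* c L)
    (constant (λ cL≡0 → [ c≢0 , L≢0 ]′ (ℕP.m*n≡0⇒m≡0∨n≡0 c cL≡0)))
scale-hasDegree c≢0 (shift h) = shift (scale-hasDegree c≢0 h)

⊕-hasDegree : ∀ {p k L} q → HasDegree p k L → length q ≤ k → HasDegree (p ⊕ q) k L
⊕-hasDegree []      (constant L≢0) _         = constant L≢0
⊕-hasDegree []      (shift h)      _         = shift h
⊕-hasDegree (_ ∷ q) (shift h)      (s≤s q≤k) = shift (⊕-hasDegree q h q≤k)

length-scale : ∀ c p → length (scale c p) ≡ length p
length-scale c = ListP.length-map (c ℤ.*_)

⊖-hasDegree : ∀ {p k L} q → HasDegree p k L → length q ≤ k → HasDegree (p ⊖ q) k L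
⊖-hasDegree q h q≤k =
  ⊕-hasDegree _ h (≡.subst (_≤ _) (≡.sym (length-scale (ℤ.- (+ 1)) q)) q≤k)

∸-suc : ∀ {m k} → k < m → m ∸ k ≡ suc (m ∸ suc k)
∸-suc = ℕP.+-∸-assoc 1

module LeadingCoefficients (n : ℕ) (d : Fin n → ℕ) where

  ext-≥ : ∀ {j} → n ≤ j → ext n d j ≡ 0
  ext-≥ {j} n≤j with j ℕ.<? n
  ... | yes j<n = ⊥-elim (ℕP.<⇒≱ j<n n≤j)
  ... | no  _   = ≡.refl

  ext-< : (∀ i → 1 ≤ d i) → ∀ {j} → j < n → 1 ≤ ext n d j
  ext-< d≥1 {j} j<n with j ℕ.<? n
  ... | yes _   = d≥1 _
  ... | no  j≮n = ⊥-elim (j≮n j<n)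

  stepFactor : ℕ → ℕ
  stepFactor k with suc k ℕ.≟ n
  ... | yes _ = ext n d 0
  ... | no  _ = suc (ext n d (n ∸ suc k))

  leadCoeff : ℕ → ℕ
  leadCoeff zero          = 1
  leadCoeff (suc zero)    = 1
  leadCoeff (suc (suc k)) = stepFactor k ℕ.* leadCoeff (suc k)

  gstep-hasDegree : 1 ≤ n → (∀ i → 1 ≤ d i) → ∀ k {g₁ g₀ L} →
                    HasDegree g₁ (suc k) L → length g₀ ≤ suc k →
                    HasDegree (gstep n d k g₁ g₀) (suc (suc k)) (stepFactor k ℕ.* L)
  gstep-hasDegree n≥1 d≥1 k {g₀ = g₀} h₁ g₀≤ with suc k ℕ.≟ n
  ... | yes _ = scale-hasDegree (ℕP.n>0⇒n≢0 (ext-< d≥1 n≥1))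
                  (⊖-hasDegree g₀ (shift h₁) (ℕP.m≤n⇒m≤1+n g₀≤))
  ... | no  _ = ⊖-hasDegree (scale (+ e) g₀) (scale-hasDegree {suc e} (λ ()) (shift h₁))
                  (≡.subst (_≤ _) (≡.sym (length-scale (+ e) g₀)) (ℕP.m≤n⇒m≤1+n g₀≤))
    where e = ext n d (n ∸ suc k)

  g-hasDegree : 1 ≤ n → (∀ i → 1 ≤ d i) → ∀ i → HasDegree (g n d i) i (leadCoeff i)
  g-hasDegree _   _   zero          = constant (λ ())
  g-hasDegree _   _   (suc zero)    = shift (constant (λ ()))
  g-hasDegree n≥1 d≥1 (suc (suc k)) =
    gstep-hasDegree n≥1 d≥1 k (g-hasDegree n≥1 d≥1 (suc k))
      (ℕP.≤-reflexive (length-hasDegree (g-hasDegree n≥1 d≥1 k)))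

  leadCoeff-suc : ∀ {k} → k < n → leadCoeff (suc k) ≡ suc (ext n d (n ∸ k)) ℕ.* leadCoeff k
  leadCoeff-suc {zero} _ = ≡.cong (λ e → suc e ℕ.* 1) (≡.sym (ext-≥ ℕP.≤-refl))
  leadCoeff-suc {suc k} k<n with suc k ℕ.≟ n
  ... | yes k≡n = ⊥-elim (ℕP.<-irrefl k≡n k<n)
  ... | no  _   = ≡.refl

  leadCoeff-last : ∀ {k} → suc k ≡ n → leadCoeff (suc (suc k)) ≡ ext n d 0 ℕ.* leadCoeff (suc k)
  leadCoeff-last {k} k≡n with suc k ℕ.≟ n
  ... | yes _   = ≡.refl
  ... | no  k≢n = ⊥-elim (k≢n k≡n)

module _ {c ℓ : Level} (F : CharZeroField c ℓ) where
  open CharZeroField F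
  open WithField F
  open import Relation.Binary.Reasoning.Setoid setoid
  open import Algebra.Properties.Ring ring
    using (-1*x≈-x; -‿involutive; -0#≈0#; -‿distribˡ-*; -‿distribʳ-*)
  open import Algebra.Properties.AbelianGroup +-abelianGroup using (⁻¹-∙-comm; xyx⁻¹≈y)
  open import Algebra.Properties.Semiring.Mult semiring using (×-homo-+; ×1-homo-*)
    renaming (_×_ to _·_)

  natK≡·1 : ∀ m → natK m ≡ m · 1#
  natK≡·1 zero    = ≡.refl
  natK≡·1 (suc m) = ≡.cong (λ r → 1# + r) (natK≡·1 m)

  natK-homo-+ : ∀ m n → natK (m ℕ.+ n) ≈ natK m + natK n
  natK-homo-+ m n rewrite natK≡·1 m | natK≡·1 n | natK≡·1 (m ℕ.+ n) = ×-homo-+ 1# m n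

  natK-homo-* : ∀ m n → natK (m ℕ.* n) ≈ natK m * natK n
  natK-homo-* m n rewrite natK≡·1 m | natK≡·1 n | natK≡·1 (m ℕ.* n) = ×1-homo-* m n

  intK-homo-neg : ∀ i → intK (ℤ.- i) ≈ - intK i
  intK-homo-neg (+ zero)  = sym -0#≈0#
  intK-homo-neg (+ suc m) = refl
  intK-homo-neg -[1+ m ]  = sym (-‿involutive _)

  intK-⊖ : ∀ m n → intK (m ℤ.⊖ n) ≈ natK m - natK n
  intK-⊖ m       zero    = sym (trans (+-congˡ -0#≈0#) (+-identityʳ _))
  intK-⊖ zero    (suc n) = sym (+-identityˡ _)
  intK-⊖ (suc m) (suc n) = begin
    intK (suc m ℤ.⊖ suc n)          ≡⟨ ≡.cong intK (ℤP.[1+m]⊖[1+n]≡m⊖n m n) ⟩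
    intK (m ℤ.⊖ n)                  ≈⟨ intK-⊖ m n ⟩
    natK m - natK n                 ≈⟨ sym (+-congʳ (xyx⁻¹≈y 1# (natK m))) ⟩
    1# + natK m - 1# - natK n       ≈⟨ +-assoc _ _ _ ⟩
    1# + natK m + (- 1# - natK n)   ≈⟨ +-congˡ (⁻¹-∙-comm 1# (natK n)) ⟩
    natK (suc m) - natK (suc n)     ∎

  intK-homo-+ : ∀ i j → intK (i ℤ.+ j) ≈ intK i + intK j
  intK-homo-+ (+ m)    (+ n)    = natK-homo-+ m n
  intK-homo-+ (+ m)    -[1+ n ] = intK-⊖ m (suc n)
  intK-homo-+ -[1+ m ] (+ n)    = trans (intK-⊖ n (suc m)) (+-comm _ _)
  intK-homo-+ -[1+ m ] -[1+ n ] = begin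
    - natK (suc (suc m ℕ.+ n))        ≡⟨ ≡.cong (λ k → - natK k) (≡.sym (ℕP.+-suc (suc m) n)) ⟩
    - natK (suc m ℕ.+ suc n)          ≈⟨ -‿cong (natK-homo-+ (suc m) (suc n)) ⟩
    - (natK (suc m) + natK (suc n))   ≈⟨ sym (⁻¹-∙-comm _ _) ⟩
    - natK (suc m) - natK (suc n)     ∎

  intK-negative : ∀ m → intK (Sign.- ℤ.◃ m) ≈ - natK m
  intK-negative m = trans (reflexive (≡.cong intK (ℤP.-◃n≡-n m))) (intK-homo-neg (+ m))

  intK-homo-* : ∀ i j → intK (i ℤ.* j) ≈ intK i * intK j
  intK-homo-* (+ m) (+ n) = trans (reflexive (≡.cong intK (ℤP.+◃n≡+n (m ℕ.* n)))) (natK-homo-* m n)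
  intK-homo-* (+ m) -[1+ n ] = begin
    intK (Sign.- ℤ.◃ (m ℕ.* suc n))   ≈⟨ intK-negative (m ℕ.* suc n) ⟩
    - natK (m ℕ.* suc n)              ≈⟨ -‿cong (natK-homo-* m (suc n)) ⟩
    - (natK m * natK (suc n))         ≈⟨ -‿distribʳ-* _ _ ⟩
    natK m * - natK (suc n)           ∎
  intK-homo-* -[1+ m ] (+ n) = begin
    intK (Sign.- ℤ.◃ (suc m ℕ.* n))   ≈⟨ intK-negative (suc m ℕ.* n) ⟩
    - natK (suc m ℕ.* n)              ≈⟨ -‿cong (natK-homo-* (suc m) n) ⟩
    - (natK (suc m) * natK n)         ≈⟨ -‿distribˡ-* _ _ ⟩
    - natK (suc m) * natK n           ∎
  intK-homo-* -[1+ m ] -[1+ n ] = begin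
    natK (suc m ℕ.* suc n)                ≈⟨ natK-homo-* (suc m) (suc n) ⟩
    natK (suc m) * natK (suc n)           ≈⟨ sym (-‿involutive _) ⟩
    - - (natK (suc m) * natK (suc n))     ≈⟨ -‿cong (-‿distribˡ-* _ _) ⟩
    - (- natK (suc m) * natK (suc n))     ≈⟨ -‿distribʳ-* _ _ ⟩
    - natK (suc m) * - natK (suc n)       ∎

  intK-morphism : ℤ.+-*-rawRing ACR.-Raw-AlmostCommutative⟶ ACR.fromCommutativeRing cring
  intK-morphism = record
    { ⟦_⟧    = intK
    ; +-homo = intK-homo-+
    ; *-homo = intK-homo-*
    ; -‿homo = intK-homo-neg
    ; 0-homo = refl
    ; 1-homo = +-identityʳ 1#
    }

  intK-≟ : ∀ i j → Maybe (intK i ≈ intK j)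
  intK-≟ i j with i ℤ.≟ j
  ... | yes ≡.refl = just refl
  ... | no  _      = nothing

  open import Algebra.Solver.Ring ℤ.+-*-rawRing (ACR.fromCommutativeRing cring) intK-morphism intK-≟
    using (solve; _:=_; _:+_; _:*_; _:-_; con)

  *-≉0 : ∀ {x y} → x ≉ 0# → y ≉ 0# → x * y ≉ 0#
  *-≉0 {x} {y} x≉0 y≉0 xy≈0 = y≉0 (begin
    y                    ≈⟨ sym (*-identityˡ y) ⟩
    1# * y               ≈⟨ *-congʳ (sym (trans (*-comm _ _) (inv-law x x≉0))) ⟩
    inv x * x * y        ≈⟨ *-assoc _ _ _ ⟩
    inv x * (x * y)      ≈⟨ *-congˡ xy≈0 ⟩
    inv x * 0#           ≈⟨ zeroʳ _ ⟩
    0#                   ∎)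

  inv-unique : ∀ {x y} → x ≉ 0# → x * y ≈ 1# → y ≈ inv x
  inv-unique {x} {y} x≉0 xy≈1 = begin
    y                    ≈⟨ sym (*-identityʳ y) ⟩
    y * 1#               ≈⟨ *-congˡ (sym (inv-law x x≉0)) ⟩
    y * (x * inv x)      ≈⟨ sym (*-assoc _ _ _) ⟩
    y * x * inv x        ≈⟨ *-congʳ (trans (*-comm _ _) xy≈1) ⟩
    1# * inv x           ≈⟨ *-identityˡ _ ⟩
    inv x                ∎

  inv-cong : ∀ {x y} → x ≉ 0# → x ≈ y → inv x ≈ inv y
  inv-cong {x} {y} x≉0 x≈y =
    inv-unique y≉0 (trans (*-congʳ (sym x≈y)) (inv-law x x≉0))
    where y≉0 = λ y≈0 → x≉0 (trans x≈y y≈0)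

  inv-distrib-* : ∀ {x y} → x ≉ 0# → y ≉ 0# → inv (x * y) ≈ inv x * inv y
  inv-distrib-* {x} {y} x≉0 y≉0 = sym (inv-unique (*-≉0 x≉0 y≉0) (begin
    x * y * (inv x * inv y)
      ≈⟨ solve 4 (λ x y x′ y′ → x :* y :* (x′ :* y′) := x :* x′ :* (y :* y′))
           refl x y (inv x) (inv y) ⟩
    x * inv x * (y * inv y)       ≈⟨ *-cong (inv-law x x≉0) (inv-law y y≉0) ⟩
    1# * 1#                       ≈⟨ *-identityˡ 1# ⟩
    1#                            ∎))

  inv-cancelˡ : ∀ {x y} → y ≉ 0# → inv y * (x * y) ≈ x
  inv-cancelˡ {x} {y} y≉0 = begin
    inv y * (x * y)   ≈⟨ solve 3 (λ x y y′ → y′ :* (x :* y) := x :* (y :* y′)) refl x y (inv y) ⟩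
    x * (y * inv y)   ≈⟨ *-congˡ (inv-law y y≉0) ⟩
    x * 1#            ≈⟨ *-identityʳ x ⟩
    x                 ∎

  inv-cancelʳ : ∀ {x y} → y ≉ 0# → x * inv y * y ≈ x
  inv-cancelʳ {x} {y} y≉0 = begin
    x * inv y * y     ≈⟨ solve 3 (λ x y y′ → x :* y′ :* y := x :* (y :* y′)) refl x y (inv y) ⟩
    x * (y * inv y)   ≈⟨ *-congˡ (inv-law y y≉0) ⟩
    x * 1#            ≈⟨ *-identityʳ x ⟩
    x                 ∎

  natK-≉0 : ∀ {m} → m ≢ 0 → natK m ≉ 0#
  natK-≉0 {zero}  m≢0 = ⊥-elim (m≢0 ≡.refl)
  natK-≉0 {suc m} _   = charZero m

  eval-⊕ : ∀ q r x → eval (q ⊕ r) x ≈ eval q x + eval r x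
  eval-⊕ []      r       x = sym (+-identityˡ _)
  eval-⊕ (a ∷ q) []      x = sym (+-identityʳ _)
  eval-⊕ (a ∷ q) (b ∷ r) x = begin
    intK (a ℤ.+ b) + x * eval (q ⊕ r) x
      ≈⟨ +-cong (intK-homo-+ a b) (*-congˡ (eval-⊕ q r x)) ⟩
    intK a + intK b + x * (eval q x + eval r x)
      ≈⟨ solve 5 (λ a b x q r → a :+ b :+ x :* (q :+ r) := a :+ x :* q :+ (b :+ x :* r))
           refl (intK a) (intK b) x (eval q x) (eval r x) ⟩
    intK a + x * eval q x + (intK b + x * eval r x) ∎

  eval-scale : ∀ a q x → eval (scale a q) x ≈ intK a * eval q x
  eval-scale a []      x = sym (zeroʳ (intK a))
  eval-scale a (b ∷ q) x = begin
    intK (a ℤ.* b) + x * eval (scale a q) x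
      ≈⟨ +-cong (intK-homo-* a b) (*-congˡ (eval-scale a q x)) ⟩
    intK a * intK b + x * (intK a * eval q x)
      ≈⟨ solve 4 (λ a b x q → a :* b :+ x :* (a :* q) := a :* (b :+ x :* q))
           refl (intK a) (intK b) x (eval q x) ⟩
    intK a * (intK b + x * eval q x) ∎

  eval-⊖ : ∀ q r x → eval (q ⊖ r) x ≈ eval q x - eval r x
  eval-⊖ q r x = begin
    eval (q ⊕ scale (ℤ.- (+ 1)) r) x          ≈⟨ eval-⊕ q _ x ⟩
    eval q x + eval (scale (ℤ.- (+ 1)) r) x   ≈⟨ +-congˡ (eval-scale (ℤ.- (+ 1)) r x) ⟩
    eval q x + intK (ℤ.- (+ 1)) * eval r x    ≈⟨ solve 2 (λ q r → q :+ con (ℤ.- (+ 1)) :* r := q :- r)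
                                                   refl (eval q x) (eval r x) ⟩
    eval q x - eval r x                        ∎

  eval-mulX : ∀ q x → eval (mulX q) x ≈ x * eval q x
  eval-mulX q x = +-identityˡ _

  monic-recurrence : ∀ {A B L e c x E₀ E₁ E₂} → A ≉ 0# → B ≉ 0# → L ≉ 0# →
                     c * (A * B) ≈ e → E₂ ≈ A * (x * E₁) - e * E₀ →
                     inv (A * (B * L)) * E₂ ≈ x * (inv (B * L) * E₁) - c * (inv L * E₀)
  monic-recurrence {A} {B} {L} {e} {c} {x} {E₀} {E₁} {E₂} A≉0 B≉0 L≉0 cAB≈e E₂≈ = begin
    inv (A * (B * L)) * E₂
      ≈⟨ *-cong (trans (inv-distrib-* A≉0 (*-≉0 B≉0 L≉0)) (*-congˡ (inv-distrib-* B≉0 L≉0)))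
                (trans E₂≈ (+-congˡ (-‿cong (*-congʳ (sym cAB≈e))))) ⟩
    inv A * (inv B * inv L) * (A * (x * E₁) - c * (A * B) * E₀)
      ≈⟨ solve 9 (λ A B A′ B′ L′ c x E₀ E₁ →
                    A′ :* (B′ :* L′) :* (A :* (x :* E₁) :- c :* (A :* B) :* E₀)
                 := A :* A′ :* (x :* (B′ :* L′ :* E₁)) :- A :* A′ :* (B :* B′) :* (c :* (L′ :* E₀)))
           refl A B (inv A) (inv B) (inv L) c x E₀ E₁ ⟩
    A * inv A * (x * (inv B * inv L * E₁)) - A * inv A * (B * inv B) * (c * (inv L * E₀))
      ≈⟨ +-cong (*-congʳ (inv-law A A≉0))
                (-‿cong (*-congʳ (*-cong (inv-law A A≉0) (inv-law B B≉0)))) ⟩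
    1# * (x * (inv B * inv L * E₁)) - 1# * 1# * (c * (inv L * E₀))
      ≈⟨ +-cong (*-identityˡ _) (-‿cong (trans (*-congʳ (*-identityˡ 1#)) (*-identityˡ _))) ⟩
    x * (inv B * inv L * E₁) - c * (inv L * E₀)
      ≈⟨ +-congʳ (*-congˡ (*-congʳ (sym (inv-distrib-* B≉0 L≉0)))) ⟩
    x * (inv (B * L) * E₁) - c * (inv L * E₀) ∎

  ThreeTermRecurrence : ℕ → Carrier → (ℕ → Carrier) → (ℕ → Carrier) → Set ℓ
  ThreeTermRecurrence N x c u = ∀ k → suc k ≤ N → u (suc (suc k)) ≈ x * u (suc k) - c k * u k

  recurrence-unique : ∀ {N x c u v} → ThreeTermRecurrence N x c u → ThreeTermRecurrence N x c v →
                      u 0 ≈ v 0 → u 1 ≈ v 1 → ∀ i → i ≤ suc N → u i ≈ v i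
  recurrence-unique {N} {x} {c} {u} {v} rec-u rec-v u₀≈v₀ u₁≈v₁ = agree
    where
    agree-pair : ∀ k → k ≤ N → u k ≈ v k × u (suc k) ≈ v (suc k)
    agree-pair zero    _   = u₀≈v₀ , u₁≈v₁
    agree-pair (suc k) k<N with agree-pair k (ℕP.<⇒≤ k<N)
    ... | uₖ≈vₖ , uₖ₊₁≈vₖ₊₁ = uₖ₊₁≈vₖ₊₁ , (begin
      u (suc (suc k))               ≈⟨ rec-u k k<N ⟩
      x * u (suc k) - c k * u k
        ≈⟨ +-cong (*-congˡ uₖ₊₁≈vₖ₊₁) (-‿cong (*-congˡ uₖ≈vₖ)) ⟩
      x * v (suc k) - c k * v k     ≈⟨ sym (rec-v k k<N) ⟩
      v (suc (suc k))               ∎)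

    agree : ∀ i → i ≤ suc N → u i ≈ v i
    agree zero    _     = u₀≈v₀
    agree (suc i) i<1+N = proj₂ (agree-pair i (ℕP.≤-pred i<1+N))

  sumFin-cong : ∀ m {f h : Fin m → Carrier} → (∀ j → f j ≈ h j) → sumFin m f ≈ sumFin m h
  sumFin-cong zero    _   = refl
  sumFin-cong (suc m) f≈h = +-cong (f≈h Fin.zero) (sumFin-cong m (λ j → f≈h (Fin.suc j)))

  sumFin-≈0 : ∀ m {f : Fin m → Carrier} → (∀ j → f j ≈ 0#) → sumFin m f ≈ 0#
  sumFin-≈0 m f≈0 = trans (sumFin-cong m f≈0) (sumFin-0# m)
    where
    sumFin-0# : ∀ m → sumFin m (λ _ → 0#) ≈ 0#
    sumFin-0# zero    = refl
    sumFin-0# (suc m) = trans (+-identityˡ _) (sumFin-0# m)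

  laplaceTerm : ∀ m → (Fin (suc m) → Fin (suc m) → Carrier) → Fin (suc m) → Carrier
  laplaceTerm m A j = sgn (toℕ j) * (A Fin.zero j * det m (λ a b → A (Fin.suc a) (Fin.punchIn j b)))

  det-cong : ∀ m {A B : Fin m → Fin m → Carrier} → (∀ a b → A a b ≈ B a b) → det m A ≈ det m B
  det-cong zero    _   = refl
  det-cong (suc m) {A} {B} A≈B = sumFin-cong (suc m) {laplaceTerm m A} {laplaceTerm m B} λ j →
    *-congˡ (*-cong (A≈B Fin.zero j) (det-cong m λ a b → A≈B (Fin.suc a) (Fin.punchIn j b)))

  term-≈0ˡ : ∀ {u a b} → a ≈ 0# → u * (a * b) ≈ 0#
  term-≈0ˡ a≈0 = trans (*-congˡ (trans (*-congʳ a≈0) (zeroˡ _))) (zeroʳ _)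

  term-≈0ʳ : ∀ {u a b} → b ≈ 0# → u * (a * b) ≈ 0#
  term-≈0ʳ b≈0 = trans (*-congˡ (trans (*-congˡ b≈0) (zeroʳ _))) (zeroʳ _)

  det-zeroColumn : ∀ m (A : Fin (suc m) → Fin (suc m) → Carrier) →
                   (∀ a → A a Fin.zero ≈ 0#) → det (suc m) A ≈ 0#
  det-zeroColumn zero    A col≈0 = trans (+-identityʳ _) (term-≈0ˡ (col≈0 Fin.zero))
  det-zeroColumn (suc m) A col≈0 = sumFin-≈0 (suc (suc m)) {laplaceTerm (suc m) A} λ
    { Fin.zero    → term-≈0ˡ (col≈0 Fin.zero)
    ; (Fin.suc j) → term-≈0ʳ (det-zeroColumn m (λ a b → A (Fin.suc a) (Fin.punchIn (Fin.suc j) b))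
                                                (λ a → col≈0 (Fin.suc a)))
    }

  det-zeroBelow : ∀ m (A : Fin (suc m) → Fin (suc m) → Carrier) →
                  (∀ a → A (Fin.suc a) Fin.zero ≈ 0#) →
                  det (suc m) A ≈ A Fin.zero Fin.zero * det m (λ a b → A (Fin.suc a) (Fin.suc b))
  det-zeroBelow zero    A _     = trans (+-cong (*-identityˡ _) refl) (+-identityʳ _)
  det-zeroBelow (suc m) A col≈0 = trans (+-cong (*-identityˡ _) rest≈0) (+-identityʳ _)
    where
    rest≈0 = sumFin-≈0 (suc m) {λ j → laplaceTerm (suc m) A (Fin.suc j)} λ j →
      term-≈0ʳ (det-zeroColumn m (λ a b → A (Fin.suc a) (Fin.punchIn (Fin.suc j) b)) col≈0)

  det-tridiagonal : ∀ m (A : Fin (suc (suc m)) → Fin (suc (suc m)) → Carrier) →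
    (∀ j → A Fin.zero (Fin.suc (Fin.suc j)) ≈ 0#) → (∀ a → A (Fin.suc (Fin.suc a)) Fin.zero ≈ 0#) →
    det (suc (suc m)) A ≈ A Fin.zero Fin.zero * det (suc m) (λ a b → A (Fin.suc a) (Fin.suc b))
      - A Fin.zero (Fin.suc Fin.zero) * A (Fin.suc Fin.zero) Fin.zero
        * det m (λ a b → A (Fin.suc (Fin.suc a)) (Fin.suc (Fin.suc b)))
  -- Expanding along the first row, only the a₀₀ and a₀₁ terms survive, and the minor of a₀₁ has
  -- first column a₁₀, 0, …, 0.
  det-tridiagonal m A row≈0 col≈0 = begin
    1# * (a₀₀ * D₁) + (- 1# * (a₀₁ * det (suc m) A₁) + rest)
      ≈⟨ +-cong (*-identityˡ _) (trans (+-cong (-1*x≈-x _) rest≈0) (+-identityʳ _)) ⟩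
    a₀₀ * D₁ - a₀₁ * det (suc m) A₁
      ≈⟨ +-congˡ (-‿cong (*-congˡ (det-zeroBelow m A₁ col≈0))) ⟩
    a₀₀ * D₁ - a₀₁ * (a₁₀ * D₂)
      ≈⟨ +-congˡ (-‿cong (sym (*-assoc _ _ _))) ⟩
    a₀₀ * D₁ - a₀₁ * a₁₀ * D₂ ∎
    where
    a₀₀ = A Fin.zero Fin.zero
    a₀₁ = A Fin.zero (Fin.suc Fin.zero)
    a₁₀ = A (Fin.suc Fin.zero) Fin.zero
    D₁ = det (suc m) (λ a b → A (Fin.suc a) (Fin.suc b))
    D₂ = det m (λ a b → A (Fin.suc (Fin.suc a)) (Fin.suc (Fin.suc b)))
    A₁ = λ a b → A (Fin.suc a) (Fin.punchIn (Fin.suc Fin.zero) b)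
    rest = sumFin m (λ j → laplaceTerm (suc m) A (Fin.suc (Fin.suc j)))
    rest≈0 : rest ≈ 0#
    rest≈0 = sumFin-≈0 m {λ j → laplaceTerm (suc m) A (Fin.suc (Fin.suc j))} λ j →
      term-≈0ˡ (row≈0 j)

  I-suc : ∀ m (a b : Fin m) → I (suc m) (Fin.suc a) (Fin.suc b) ≡ I m a b
  I-suc m a b with a Fin.≟ b
  ... | yes _ = ≡.refl
  ... | no  _ = ≡.refl

  M-diag : ∀ s j → M s j j ≡ 0#
  M-diag s j with j ℕ.≟ suc j
  ... | yes j≡1+j = ⊥-elim (ℕP.1+n≢n (≡.sym j≡1+j))
  ... | no  _     = ≡.refl

  M-above : ∀ s j → M s j (suc j) ≡ s j
  M-above s j with suc j ℕ.≟ suc j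
  ... | yes _ = ≡.refl
  ... | no  neq = ⊥-elim (neq ≡.refl)

  M-below : ∀ s j → M s (suc j) j ≡ s j
  M-below s j with j ℕ.≟ suc (suc j) | suc j ℕ.≟ suc j
  ... | yes j≡2+j | _     = ⊥-elim (ℕP.m≢1+n+m j j≡2+j)
  ... | no  _     | yes _ = ≡.refl
  ... | no  _     | no  neq = ⊥-elim (neq ≡.refl)

  M-farAbove : ∀ s j k → M s j (suc (suc (k ℕ.+ j))) ≡ 0#
  M-farAbove s j k with suc (suc (k ℕ.+ j)) ℕ.≟ suc j | j ℕ.≟ suc (suc (suc (k ℕ.+ j)))
  ... | yes eq | _      = ⊥-elim (ℕP.m≢1+n+m j (≡.sym (ℕP.suc-injective eq)))
  ... | no  _  | yes eq = ⊥-elim (ℕP.m≢1+n+m j eq)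
  ... | no  _  | no  _  = ≡.refl

  M-farBelow : ∀ s j k → M s (suc (suc (k ℕ.+ j))) j ≡ 0#
  M-farBelow s j k with j ℕ.≟ suc (suc (suc (k ℕ.+ j))) | suc (suc (k ℕ.+ j)) ℕ.≟ suc j
  ... | yes eq | _      = ⊥-elim (ℕP.m≢1+n+m j eq)
  ... | no  _  | yes eq = ⊥-elim (ℕP.m≢1+n+m j (≡.sym (ℕP.suc-injective eq)))
  ... | no  _  | no  _  = ≡.refl

  -- The window of λI − M on the indices base, …, base+m−1; p n s i x is
  -- definitionally charPoly s x (suc n ∸ i) i.
  charMatrix : (ℕ → Carrier) → Carrier → ℕ → (m : ℕ) → Fin m → Fin m → Carrier
  charMatrix s x base m a b = x * I m a b - M s (toℕ a ℕ.+ base) (toℕ b ℕ.+ base)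

  charPoly : (ℕ → Carrier) → Carrier → ℕ → ℕ → Carrier
  charPoly s x base m = det m (charMatrix s x base m)

  charMatrix-entry : ∀ s x base m (a b : Fin m) {i v} →
                     I m a b ≡ i → M s (toℕ a ℕ.+ base) (toℕ b ℕ.+ base) ≡ v →
                     charMatrix s x base m a b ≡ x * i - v
  charMatrix-entry s x base m a b = ≡.cong₂ (λ i v → x * i - v)

  charMatrix-shift : ∀ s x base m (a b : Fin m) →
                     charMatrix s x base (suc m) (Fin.suc a) (Fin.suc b) ≡ charMatrix s x (suc base) m a b
  charMatrix-shift s x base m a b = charMatrix-entry s x base (suc m) (Fin.suc a) (Fin.suc b) (I-suc m a b)
    (≡.cong₂ (M s) (≡.sym (ℕP.+-suc (toℕ a) base)) (≡.sym (ℕP.+-suc (toℕ b) base)))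

  x*0-0≈0 : ∀ x → x * 0# - 0# ≈ 0#
  x*0-0≈0 x = trans (+-cong (zeroʳ x) -0#≈0#) (+-identityˡ 0#)

  x*1-0≈x : ∀ x → x * 1# - 0# ≈ x
  x*1-0≈x x = trans (+-cong (*-identityʳ x) -0#≈0#) (+-identityʳ x)

  charPoly-one : ∀ s x base → charPoly s x base 1 ≈ x
  charPoly-one s x base = begin
    1# * ((x * 1# - M s base base) * 1#) + 0#
      ≡⟨ ≡.cong (λ v → 1# * ((x * 1# - v) * 1#) + 0#) (M-diag s base) ⟩
    1# * ((x * 1# - 0#) * 1#) + 0#
      ≈⟨ trans (+-identityʳ _) (trans (*-identityˡ _) (*-identityʳ _)) ⟩
    x * 1# - 0#
      ≈⟨ x*1-0≈x x ⟩
    x ∎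

  charPoly-suc-suc : ∀ s x base m →
    charPoly s x base (suc (suc m))
      ≈ x * charPoly s x (suc base) (suc m) - s base * s base * charPoly s x (suc (suc base)) m
  charPoly-suc-suc s x base m = begin
    det (suc (suc m)) A
      ≈⟨ det-tridiagonal m A row≈0 col≈0 ⟩
    A Fin.zero Fin.zero * det (suc m) (λ a b → A (Fin.suc a) (Fin.suc b))
      - A Fin.zero (Fin.suc Fin.zero) * A (Fin.suc Fin.zero) Fin.zero
        * det m (λ a b → A (Fin.suc (Fin.suc a)) (Fin.suc (Fin.suc b)))
      ≈⟨ +-cong (*-cong a₀₀≈x (det-cong (suc m) λ a b → reflexive (shift¹ a b)))
                (-‿cong (*-cong a₀₁a₁₀≈s² (det-cong m λ a b → reflexive (shift² a b)))) ⟩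
    x * charPoly s x (suc base) (suc m) - s base * s base * charPoly s x (suc (suc base)) m ∎
    where
    A = charMatrix s x base (suc (suc m))
    entry : ∀ a b {i v} → I (suc (suc m)) a b ≡ i → M s (toℕ a ℕ.+ base) (toℕ b ℕ.+ base) ≡ v →
            A a b ≡ x * i - v
    entry = charMatrix-entry s x base (suc (suc m))
    row≈0 : ∀ j → A Fin.zero (Fin.suc (Fin.suc j)) ≈ 0#
    row≈0 j = trans (reflexive (entry Fin.zero (Fin.suc (Fin.suc j)) ≡.refl (M-farAbove s base (toℕ j))))
                    (x*0-0≈0 x)
    col≈0 : ∀ a → A (Fin.suc (Fin.suc a)) Fin.zero ≈ 0#
    col≈0 a = trans (reflexive (entry (Fin.suc (Fin.suc a)) Fin.zero ≡.refl (M-farBelow s base (toℕ a))))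
                    (x*0-0≈0 x)
    a₀₀≈x : A Fin.zero Fin.zero ≈ x
    a₀₀≈x = trans (reflexive (entry Fin.zero Fin.zero ≡.refl (M-diag s base))) (x*1-0≈x x)
    a₀₁a₁₀≈s² : A Fin.zero (Fin.suc Fin.zero) * A (Fin.suc Fin.zero) Fin.zero ≈ s base * s base
    a₀₁a₁₀≈s² = begin
      A Fin.zero (Fin.suc Fin.zero) * A (Fin.suc Fin.zero) Fin.zero
        ≡⟨ ≡.cong₂ _*_ (entry Fin.zero (Fin.suc Fin.zero) ≡.refl (M-above s base))
                       (entry (Fin.suc Fin.zero) Fin.zero ≡.refl (M-below s base)) ⟩
      (x * 0# - s base) * (x * 0# - s base)
        ≈⟨ solve 2 (λ x σ → (x :* con (+ 0) :- σ) :* (x :* con (+ 0) :- σ) := σ :* σ)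
             refl x (s base) ⟩
      s base * s base ∎
    shift¹ : ∀ a b → A (Fin.suc a) (Fin.suc b) ≡ charMatrix s x (suc base) (suc m) a b
    shift¹ = charMatrix-shift s x base (suc m)
    shift² : ∀ a b → A (Fin.suc (Fin.suc a)) (Fin.suc (Fin.suc b)) ≡ charMatrix s x (suc (suc base)) m a b
    shift² a b = ≡.trans (shift¹ (Fin.suc a) (Fin.suc b))
                         (charMatrix-shift s x (suc base) m a b)

  p-recurrence : ∀ n d s x → (∀ j → j < n → s j * s j ≈ D n d j) →
                 ThreeTermRecurrence n x (λ k → D n d (n ∸ suc k)) (λ i → p n s i x)
  p-recurrence n d s x s²≈D k k<n = begin
    charPoly s x b (suc (suc k))
      ≈⟨ charPoly-suc-suc s x b k ⟩
    x * charPoly s x (suc b) (suc k) - s b * s b * charPoly s x (suc (suc b)) k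
      ≡⟨ ≡.cong₂ (λ b₁ b₂ → x * charPoly s x b₁ (suc k) - s b * s b * charPoly s x b₂ k)
                 (≡.sym n∸k≡1+b) (≡.sym 1+n∸k≡2+b) ⟩
    x * p n s (suc k) x - s b * s b * p n s k x
      ≈⟨ +-congˡ (-‿cong (*-congʳ (s²≈D b b<n))) ⟩
    x * p n s (suc k) x - D n d b * p n s k x ∎
    where
    b = n ∸ suc k
    n∸k≡1+b : n ∸ k ≡ suc b
    n∸k≡1+b = ∸-suc k<n
    1+n∸k≡2+b : suc n ∸ k ≡ suc (suc b)
    1+n∸k≡2+b = ≡.trans (∸-suc (s≤s (ℕP.<⇒≤ k<n))) (≡.cong suc n∸k≡1+b)
    b<n : b < n
    b<n = ℕP.≤-trans (ℕP.≤-reflexive (≡.sym n∸k≡1+b)) (ℕP.m∸n≤m n k)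

  module NormalisedG (n : ℕ) (n≥1 : 1 ≤ n) (d : Fin n → ℕ) (d≥1 : ∀ i → 1 ≤ d i) (x : Carrier)
    where
    open LeadingCoefficients n d

    E : ℕ → Carrier
    E i = eval (g n d i) x

    L : ℕ → Carrier
    L i = natK (leadCoeff i)

    G : ℕ → Carrier
    G i = gTilde n d i x

    G≈ : ∀ i → G i ≈ inv (L i) * E i
    G≈ i = reflexive (≡.cong (λ a → inv (intK a) * E i) (lead-hasDegree (g-hasDegree n≥1 d≥1 i)))

    L≉0 : ∀ i → L i ≉ 0#
    L≉0 i = natK-≉0 (HasDegree⇒lead≢0 (g-hasDegree n≥1 d≥1 i))

    L-suc : ∀ {k} → k < n → L (suc k) ≈ natK (suc (ext n d (n ∸ k))) * L k
    L-suc {k} k<n = trans (reflexive (≡.cong natK (leadCoeff-suc k<n)))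
                          (natK-homo-* (suc (ext n d (n ∸ k))) (leadCoeff k))

    L-last : ∀ {k} → suc k ≡ n → L (suc (suc k)) ≈ natK (ext n d 0) * L (suc k)
    L-last {k} k≡n = trans (reflexive (≡.cong natK (leadCoeff-last k≡n)))
                           (natK-homo-* (ext n d 0) (leadCoeff (suc k)))

    E-inner : ∀ {k} → suc k ≢ n →
              E (suc (suc k))
                ≈ natK (suc (ext n d (n ∸ suc k))) * (x * E (suc k)) - natK (ext n d (n ∸ suc k)) * E k
    E-inner {k} k≢n with suc k ℕ.≟ n
    ... | yes k≡n = ⊥-elim (k≢n k≡n)
    ... | no  _   = begin
      eval (scale (+ suc e) (mulX (g n d (suc k))) ⊖ scale (+ e) (g n d k)) x
        ≈⟨ eval-⊖ (scale (+ suc e) (mulX (g n d (suc k)))) (scale (+ e) (g n d k)) x ⟩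
      eval (scale (+ suc e) (mulX (g n d (suc k)))) x - eval (scale (+ e) (g n d k)) x
        ≈⟨ +-cong (trans (eval-scale (+ suc e) (mulX (g n d (suc k))) x)
                         (*-congˡ (eval-mulX (g n d (suc k)) x)))
                  (-‿cong (eval-scale (+ e) (g n d k) x)) ⟩
      natK (suc e) * (x * E (suc k)) - natK e * E k ∎
      where e = ext n d (n ∸ suc k)

    E-last : ∀ {k} → suc k ≡ n →
             E (suc (suc k)) ≈ natK (ext n d 0) * (x * E (suc k)) - natK (ext n d 0) * E k
    E-last {k} k≡n with suc k ℕ.≟ n
    ... | no  k≢n = ⊥-elim (k≢n k≡n)
    ... | yes _   = begin
      eval (scale (+ e) (mulX (g n d (suc k)) ⊖ g n d k)) x
        ≈⟨ eval-scale (+ e) (mulX (g n d (suc k)) ⊖ g n d k) x ⟩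
      natK e * eval (mulX (g n d (suc k)) ⊖ g n d k) x
        ≈⟨ *-congˡ (trans (eval-⊖ (mulX (g n d (suc k))) (g n d k) x)
                          (+-congʳ (eval-mulX (g n d (suc k)) x))) ⟩
      natK e * (x * E (suc k) - E k)
        ≈⟨ solve 3 (λ e y z → e :* (y :- z) := e :* y :- e :* z) refl (natK e) (x * E (suc k)) (E k) ⟩
      natK e * (x * E (suc k)) - natK e * E k ∎
      where e = ext n d 0

    E-zero : E 0 ≈ 1#
    E-zero = trans (+-cong (+-identityʳ 1#) (zeroʳ x)) (+-identityʳ 1#)

    inv-natK-one : inv (natK 1) ≈ 1#
    inv-natK-one = sym (inv-unique (charZero 0) (trans (*-identityʳ _) (+-identityʳ 1#)))

    G-zero : G 0 ≈ 1#
    G-zero = trans (*-cong inv-natK-one E-zero) (*-identityˡ 1#)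

    G-one : G 1 ≈ x
    G-one = trans (*-cong inv-natK-one (trans (+-identityˡ _) (trans (*-congˡ E-zero) (*-identityʳ x))))
                  (*-identityˡ x)

    G-step : ∀ {k A B e c} → A ≉ 0# → B ≉ 0# →
             L (suc (suc k)) ≈ A * L (suc k) → L (suc k) ≈ B * L k → c * (A * B) ≈ e →
             E (suc (suc k)) ≈ A * (x * E (suc k)) - e * E k →
             G (suc (suc k)) ≈ x * G (suc k) - c * G k
    G-step {k} {A} {B} {e} {c} A≉0 B≉0 L₂≈ L₁≈ cAB≈e E₂≈ = begin
      G (suc (suc k))
        ≈⟨ G≈ (suc (suc k)) ⟩
      inv (L (suc (suc k))) * E (suc (suc k))
        ≈⟨ *-congʳ (inv-cong (L≉0 (suc (suc k))) (trans L₂≈ (*-congˡ L₁≈))) ⟩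
      inv (A * (B * L k)) * E (suc (suc k))
        ≈⟨ monic-recurrence A≉0 B≉0 (L≉0 k) cAB≈e E₂≈ ⟩
      x * (inv (B * L k) * E (suc k)) - c * (inv (L k) * E k)
        ≈⟨ +-cong (*-congˡ (*-congʳ (sym (inv-cong (L≉0 (suc k)) L₁≈))))
                  (-‿cong (*-congˡ (sym (G≈ k)))) ⟩
      x * (inv (L (suc k)) * E (suc k)) - c * G k
        ≈⟨ +-congʳ (*-congˡ (sym (G≈ (suc k)))) ⟩
      x * G (suc k) - c * G k ∎

    D-inner : ∀ {k} → suc k < n →
              D n d (n ∸ suc k) * (natK (suc (ext n d (n ∸ suc k))) * natK (suc (ext n d (n ∸ k))))
                ≈ natK (ext n d (n ∸ suc k))
    D-inner {k} k+1<n rewrite ∸-suc (ℕP.<⇒≤ k+1<n) | ∸-suc k+1<n =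
      inv-cancelʳ (*-≉0 (charZero (ext n d (suc j))) (charZero (ext n d (suc (suc j)))))
      where j = n ∸ suc (suc k)

    D-last : ∀ {k A} → suc k ≡ n → D n d (n ∸ suc k) * (A * natK (suc (ext n d (n ∸ k)))) ≈ A
    D-last k≡n rewrite ∸-suc (ℕP.≤-reflexive k≡n) | ℕP.m≤n⇒m∸n≡0 (ℕP.≤-reflexive (≡.sym k≡n)) =
      inv-cancelˡ (charZero (ext n d 1))

    G-recurrence : ThreeTermRecurrence n x (λ k → D n d (n ∸ suc k)) G
    G-recurrence k k<n = by-cases (suc k ℕ.≟ n)
      where
      by-cases : Dec (suc k ≡ n) → G (suc (suc k)) ≈ x * G (suc k) - D n d (n ∸ suc k) * G k
      by-cases (yes k≡n) = G-step (natK-≉0 (ℕP.n>0⇒n≢0 (ext-< d≥1 n≥1))) (charZero (ext n d (n ∸ k)))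
                                  (L-last k≡n) (L-suc k<n) (D-last k≡n) (E-last k≡n)
      by-cases (no k≢n) = G-step (charZero (ext n d (n ∸ suc k))) (charZero (ext n d (n ∸ k)))
                                 (L-suc k+1<n) (L-suc k<n) (D-inner k+1<n) (E-inner k≢n)
        where k+1<n = ℕP.≤∧≢⇒< k<n k≢n

lemma2p5 : ∀ {c ℓ : Level} (F : CharZeroField c ℓ) (n : ℕ) → 1 ≤ n →
           (d : Fin n → ℕ) → (∀ i → 1 ≤ d i) →
           (s : ℕ → CharZeroField.Carrier F) →
           (∀ j → j < n → CharZeroField._≈_ F (CharZeroField._*_ F (s j) (s j)) (WithField.D F n d j)) →
           ∀ (i : ℕ) → i ≤ suc n → ∀ (x : CharZeroField.Carrier F) →
           CharZeroField._≈_ F (WithField.p F n s i x) (WithField.gTilde F n d i x)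
lemma2p5 F n n≥1 d d≥1 s s²≈D i i≤1+n x =
  recurrence-unique F (p-recurrence F n d s x s²≈D) G-recurrence
    (sym G-zero) (trans (charPoly-one F s x n) (sym G-one)) i i≤1+n
  where
  open CharZeroField F using (sym; trans)
  open NormalisedG F n n≥1 d d≥1 x using (G-recurrence; G-zero; G-one)
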